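{- Let ParAlg be an algorithm whose running time on parity games with $n$ vertices and $m$ edges is at most $T(n,m)$. Then the running time of $\mathrm{TDA}(G,\sigma,\mathrm{ParAlg})$ on a parity game $G$ with $n$ vertices and $m$ edges is at most $O(mn^2)+n^2T(n,m)$.
   Context: A parity game $G=(V,E,p)$: finite directed graph in which every vertex has an outgoing edge, priorities $p:V\to\mathbb Z$; even-priority vertices belong to Even, odd ones to Odd; $V_\sigma$ the vertices of $\sigma$, $\overline\sigma$ the opponent, $N(v)$ the successors of $v$. $\max(S)$ is the set of vertices of maximum priority in $S$; $p(S)$ the common priority of a set whose elements share one. $G[X]$ is the induced subgraph. ParAlg maps a parity game and a player to a vertex subset. Algorithms: $\mathrm{Attr}(G,X,\sigma)$ is the least $C\supseteq X$ containing every $v\in V_\sigma$ with $N(v)\cap C\ne\emptyset$ and every $v\in V_{\overline\sigma}$ with $N(v)\subseteq C$. $\mathrm{SafeAttr}(G,\lambda,X,\sigma)$ is computed by iterating $C\mapsto C\cup\{v\in V_\sigma:p(v)<\lambda,\ N(v)\cap C\ne\emptyset\}\cup\{v\in V_{\overline\sigma}:p(v)<\lambda,\ N(v)\subseteq C\}$ from $C=X$ until stable. $\mathrm{Restrict}(G,\lambda,\sigma)=V\setminus\mathrm{Attr}(G,\{v:p(v)\ge\lambda\},\overline\sigma)$. $\mathrm{GenAttr}(G,\lambda,X,\sigma,\mathrm{ParAlg})$: $C:=X$; repeatedly $S:=\mathrm{SafeAttr}(G,\lambda,C,\sigma)$, $V':=\mathrm{Restrict}(G[V\setminus S],\lambda,\sigma)$,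 $C':=S\cup\mathrm{ParAlg}(G[V'],\sigma)$; return $C'$ if $C'=C$, else $C:=C'$. $\mathrm{SeqAttr}(G,X,\sigma,\mathrm{ParAlg})$: $W:=V_\sigma\cap X$, $C:=\emptyset$; while $W\ne\emptyset$: $S:=\max(W)$, $C:=\mathrm{GenAttr}(G,p(S),C\cup S,\sigma,\mathrm{ParAlg})$, $W:=W\setminus C$; return $C$. $\mathrm{TDA}(G,\sigma,\mathrm{ParAlg})$: $T:=V_\sigma$; repeatedly $C:=\mathrm{SeqAttr}(G,T,\sigma,\mathrm{ParAlg})$, $T':=T\setminus\{v\in V_\sigma:N(v)\cap C=\emptyset\}$; return $C$ if $T'=T$, else $T:=T'$. Running times refer to implementations in which attractor-type computations are carried out in time linear in the graph size. -}

module Defs where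

open import Data.Nat using (ℕ; zero; suc; _+_; _*_; _%_; _≡ᵇ_)
open import Data.Integer using (ℤ; ∣_∣; _<?_; _≤?_)
open import Data.Bool using (Bool; true; false; _∧_; _∨_; not; if_then_else_)
open import Data.Fin using (Fin; zero; suc)
open import Data.Maybe using (Maybe; just; nothing)
open import Data.Product using (_×_; _,_; ∃-syntax)
open import Relation.Nullary.Decidable using (⌊_⌋)
open import Relation.Binary.PropositionalEquality using (_≡_)

data Player : Set where
  Even Odd : Player

opp : Player → Player
opp Even = Odd
opp Odd  = Even

_==P_ : Player → Player → Bool
Even ==P Even = true
Odd  ==P Odd  = true
_    ==P _    = false

VSet : ℕ → Set
VSet n = Fin n → Bool

anyF : ∀ {n} → (Fin n → Bool) → Bool
anyF {zero}  f = false
anyF {suc n} f = f zero ∨ anyF (λ i → f (suc i))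

allF : ∀ {n} → (Fin n → Bool) → Bool
allF {zero}  f = true
allF {suc n} f = f zero ∧ allF (λ i → f (suc i))

sumF : ∀ {n} → (Fin n → ℕ) → ℕ
sumF {zero}  f = 0
sumF {suc n} f = f zero + sumF (λ i → f (suc i))

countF : ∀ {n} → (Fin n → Bool) → ℕ
countF f = sumF (λ i → if f i then 1 else 0)

firstF : ∀ {n} → (Fin n → Bool) → Maybe (Fin n)
firstF {zero}  f = nothing
firstF {suc n} f with f zero
... | true  = just zero
... | false with firstF (λ i → f (suc i))
...   | just i  = just (suc i)
...   | nothing = nothing

fullS : ∀ {n} → VSet n
fullS _ = true

emptyS : ∀ {n} → VSet n
emptyS _ = false

_∪S_ : ∀ {n} → VSet n → VSet n → VSet n
(A ∪S B) v = A v ∨ B v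

_∩S_ : ∀ {n} → VSet n → VSet n → VSet n
(A ∩S B) v = A v ∧ B v

_∖S_ : ∀ {n} → VSet n → VSet n → VSet n
(A ∖S B) v = A v ∧ not (B v)

eqS : ∀ {n} → VSet n → VSet n → Bool
eqS A B = allF (λ v → (A v ∧ B v) ∨ (not (A v) ∧ not (B v)))

iterN : {A : Set} → ℕ → (A → A) → A → A
iterN zero    f a = a
iterN (suc k) f a = f (iterN k f a)

-- Parity games on vertex set Fin n: edge relation E and priorities pr.
-- Induced subgames G[D] are represented by a vertex subset D.

record Game (n : ℕ) : Set where
  field
    E  : Fin n → Fin n → Bool
    pr : Fin n → ℤ
open Game public

owner : ∀ {n} → Game n → Fin n → Player
owner G v = if ∣ pr G v ∣ % 2 ≡ᵇ 0 then Even else Odd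

ownedBy : ∀ {n} → Game n → Player → VSet n
ownedBy G σ v = owner G v ==P σ

IsGameOn : ∀ {n} → Game n → VSet n → Set
IsGameOn G D = ∀ v → D v ≡ true → ∃[ w ] (D w ≡ true × E G v w ≡ true)

edgesIn : ∀ {n} → Game n → VSet n → ℕ
edgesIn G D = sumF (λ v → if D v then countF (λ w → D w ∧ E G v w) else 0)

-- Attractors inside the subgame G[D]  (least fixed points, reached
-- after n iterations of the monotone one-step operator)

attrStep : ∀ {n} → Game n → VSet n → Player → VSet n → VSet n
attrStep G D σ C v =
  C v ∨ (D v ∧ (if owner G v ==P σ
                then anyF (λ w → D w ∧ E G v w ∧ C w)
                else allF (λ w → not (D w ∧ E G v w) ∨ C w)))

attr : ∀ {n} → Game n → VSet n → VSet n → Player → VSet n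
attr {n} G D X σ = iterN n (attrStep G D σ) (D ∩S X)

safeStep : ∀ {n} → Game n → VSet n → ℤ → Player → VSet n → VSet n
safeStep G D λ' σ C v =
  C v ∨ (D v ∧ ⌊ pr G v <? λ' ⌋ ∧
         (if owner G v ==P σ
          then anyF (λ w → D w ∧ E G v w ∧ C w)
          else allF (λ w → not (D w ∧ E G v w) ∨ C w)))

safeAttr : ∀ {n} → Game n → VSet n → ℤ → VSet n → Player → VSet n
safeAttr {n} G D λ' X σ = iterN n (safeStep G D λ' σ) (D ∩S X)

restrict : ∀ {n} → Game n → VSet n → ℤ → Player → VSet n
restrict G D λ' σ =
  D ∖S attr G D (λ v → ⌊ λ' ≤? pr G v ⌋) (opp σ)

maxS : ∀ {n} → Game n → VSet n → VSet n
maxS G W v = W v ∧ allF (λ w → not (W w) ∨ ⌊ pr G w ≤? pr G v ⌋)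

-- Cost-instrumented algorithms.
-- A parity algorithm is given a game G and a subset D and returns its
-- answer on the subgame G[D] together with its running time.

ParAlgorithm : Set
ParAlgorithm = ∀ {k} → Game k → VSet k → Player → VSet k × ℕ

-- cost of one attractor-type (linear-time) computation on G: n + m
unitCost : ∀ {n} → Game n → ℕ
unitCost {n} G = n + edgesIn G fullS

addCost : ∀ {n} → ℕ → VSet n × ℕ → VSet n × ℕ
addCost k (C , k') = C , k + k'

module _ {n : ℕ} (G : Game n) (σ : Player) (alg : ParAlgorithm) where

  private u = unitCost G

  -- GenAttr(G, λ, X, σ, ParAlg); loop fuel n+1 suffices since C grows
  -- strictly in every non-final iteration.
  genLoop : ℕ → ℤ → VSet n → VSet n × ℕ
  genLoop zero     λ' C = C , 0
  genLoop (suc f)  λ' C with alg G (restrict G (fullS ∖S safeAttr G fullS λ' C σ) λ' σ) σ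
  ... | R , k =
    let S  = safeAttr G fullS λ' C σ
        V' = restrict G (fullS ∖S S) λ' σ
        C' = S ∪S (V' ∩S R)
    in if eqS C' C then (C' , 3 * u + k)
       else addCost (3 * u + k) (genLoop f λ' C')

  genAttr : ℤ → VSet n → VSet n × ℕ
  genAttr λ' X = genLoop (suc n) λ' X

  seqLoop : ℕ → VSet n → VSet n → VSet n × ℕ
  seqLoop zero    W C = C , 0
  seqLoop (suc f) W C with anyF W | firstF (maxS G W)
  ... | false | _       = C , u
  ... | true  | nothing = C , u
  ... | true  | just s  with genAttr (pr G s) (C ∪S maxS G W)
  ...   | C' , k with seqLoop f (W ∖S C') C'
  ...     | C'' , k' = C'' , 2 * u + k + k'

  seqAttr : VSet n → VSet n × ℕ
  seqAttr X = seqLoop (suc n) (ownedBy G σ ∩S X) emptyS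

  tdaLoop : ℕ → VSet n → VSet n × ℕ
  tdaLoop zero    T = emptyS , 0
  tdaLoop (suc f) T with seqAttr T
  ... | C , k =
    let T' = λ v → T v ∧ not (ownedBy G σ v ∧ not (anyF (λ w → E G v w ∧ C w)))
    in if eqS T' T then (C , 2 * u + k)
       else addCost (2 * u + k) (tdaLoop f T')

  tda : VSet n × ℕ
  tda = tdaLoop (suc n) (ownedBy G σ)

tdaTime : ∀ {n} → Game n → Player → ParAlgorithm → ℕ
tdaTime G σ alg with tda G σ alg
... | _ , t = t

-- Every call of ParAlg is made on Restrict(G[V ∖ S], λ, σ) for a set S closed under the
-- safe-attractor step, and such a set induces a parity game again, so each call costs at most
-- T(n, m).  A round of GenAttr costs three linear passes and one call; every round but the last
-- adds a vertex to C, and SeqAttr pays for each last round with the vertex of max(W) it adds to C,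
-- so a call of SeqAttr makes at most n rounds.  Every iteration of TDA but the last removes a
-- vertex from T, and SeqAttr on an empty T makes no rounds, so TDA makes at most n² rounds plus
-- O(n²) further linear passes.  As every vertex has a successor, n ≤ m and a pass costs O(m).

module Submission where

open import Defs
open import Data.Nat using (ℕ; zero; suc; _+_; _*_; _≤_; _<_; z≤n; s≤s)
open import Data.Nat.Properties hiding (_≤?_; _<?_)
open import Data.Nat.Tactic.RingSolver using (solve-∀)
open import Algebra.Properties.CommutativeSemigroup +-commutativeSemigroup using (x∙yz≈y∙xz; xy∙z≈y∙xz)
open import Data.Integer using (ℤ; _<?_; _≤?_)
import Data.Integer.Properties as ℤ
open import Data.Bool using (Bool; true; false; _∧_; _∨_; not; if_then_else_)
open import Data.Bool.Properties using (∨-conicalʳ; ∨-zeroʳ; ∧-conicalˡ; ∧-conicalʳ; not-injective)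
open import Data.Fin using (Fin; zero; suc)
open import Data.Maybe using (just; nothing)
open import Data.Product using (_×_; _,_; ∃-syntax; proj₁; proj₂)
open import Data.Sum using (_⊎_; inj₁; inj₂)
open import Data.Empty using (⊥-elim)
open import Function using (_∘_)
open import Relation.Nullary using (yes; no)
open import Relation.Nullary.Decidable using (⌊_⌋)
open import Relation.Binary.PropositionalEquality

∧-false : ∀ {b c} → b ≡ true → (b ∧ c) ≡ false → c ≡ false
∧-false refl b∧c≡false = b∧c≡false

∨-∧-false : ∀ a {b c} → (a ∨ (b ∧ c)) ≡ false → b ≡ true → c ≡ false
∨-∧-false a h b≡true = ∧-false b≡true (∨-conicalʳ a _ h)

not-∨-false : ∀ a {b} → (not a ∨ b) ≡ false → a ≡ true × b ≡ false
not-∨-false true refl = refl , refl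

if-true : ∀ {A : Set} {c} {x y : A} → c ≡ true → (if c then x else y) ≡ x
if-true refl = refl

if-false : ∀ {A : Set} {c} {x y : A} → c ≡ false → (if c then x else y) ≡ y
if-false refl = refl

if-elim : ∀ {A : Set} (P : A → Set) b {x y : A} → (b ≡ true → P x) → (b ≡ false → P y) → P (if b then x else y)
if-elim P true  onTrue onFalse = onTrue refl
if-elim P false onTrue onFalse = onFalse refl

==P-opp : ∀ p σ → (p ==P opp σ) ≡ not (p ==P σ)
==P-opp Even Even = refl
==P-opp Even Odd  = refl
==P-opp Odd  Even = refl
==P-opp Odd  Odd  = refl

≰ᵇ⇒>ᵇ : ∀ (i j : ℤ) → ⌊ i ≤? j ⌋ ≡ false → ⌊ j <? i ⌋ ≡ true
≰ᵇ⇒>ᵇ i j i≰j with i ≤? j | j <? i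
... | no i≰j | yes _   = refl
... | no i≰j | no j≮i = ⊥-elim (j≮i (ℤ.≰⇒> i≰j))

∃⇒anyF : ∀ {n} (f : Fin n → Bool) w → f w ≡ true → anyF f ≡ true
∃⇒anyF f zero    fw≡true rewrite fw≡true = refl
∃⇒anyF f (suc w) fw≡true with f zero
... | true  = refl
... | false = ∃⇒anyF (λ i → f (suc i)) w fw≡true

anyF⇒∃ : ∀ {n} (f : Fin n → Bool) → anyF f ≡ true → ∃[ w ] f w ≡ true
anyF⇒∃ {suc n} f any≡true with f zero in f0
... | true  = zero , f0
... | false = let w , fw = anyF⇒∃ (λ i → f (suc i)) any≡true in suc w , fw

allF⇒∀ : ∀ {n} (f : Fin n → Bool) → allF f ≡ true → ∀ w → f w ≡ true
allF⇒∀ f all≡true zero    = ∧-conicalˡ _ _ all≡true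
allF⇒∀ f all≡true (suc w) = allF⇒∀ (λ i → f (suc i)) (∧-conicalʳ (f zero) _ all≡true) w

¬allF⇒∃ : ∀ {n} (f : Fin n → Bool) → allF f ≡ false → ∃[ w ] f w ≡ false
¬allF⇒∃ {suc n} f all≡false with f zero in f0
... | false = zero , f0
... | true  = let w , fw = ¬allF⇒∃ (λ i → f (suc i)) all≡false in suc w , fw

firstF-just : ∀ {n} (f : Fin n → Bool) {s} → firstF f ≡ just s → f s ≡ true
firstF-just {suc n} f eq with f zero in f0
firstF-just {suc n} f refl | true = f0
... | false with firstF (λ i → f (suc i)) in rest
firstF-just {suc n} f refl | false | just i = firstF-just (λ i → f (suc i)) rest

anyF-cong : ∀ {n} {f g : Fin n → Bool} → f ≗ g → anyF f ≡ anyF g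
anyF-cong {zero}  f≗g = refl
anyF-cong {suc n} f≗g = cong₂ _∨_ (f≗g zero) (anyF-cong (λ i → f≗g (suc i)))

allF-cong : ∀ {n} {f g : Fin n → Bool} → f ≗ g → allF f ≡ allF g
allF-cong {zero}  f≗g = refl
allF-cong {suc n} f≗g = cong₂ _∧_ (f≗g zero) (allF-cong (λ i → f≗g (suc i)))

eqS⇒≗ : ∀ {n} (A B : VSet n) → eqS A B ≡ true → A ≗ B
eqS⇒≗ A B eq v = agree (A v) (B v) (allF⇒∀ _ eq v)
  where
  agree : ∀ a b → ((a ∧ b) ∨ (not a ∧ not b)) ≡ true → a ≡ b
  agree true  true  _ = refl
  agree false false _ = refl

¬eqS⇒∃≢ : ∀ {n} (A B : VSet n) → eqS A B ≡ false → ∃[ v ] A v ≢ B v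
¬eqS⇒∃≢ A B eq = let v , disagree = ¬allF⇒∃ _ eq in v , λ Av≡Bv → differ (A v) (B v) disagree Av≡Bv
  where
  differ : ∀ a b → ((a ∧ b) ∨ (not a ∧ not b)) ≡ false → a ≢ b
  differ true  true  () _
  differ false false () _

_⊆S_ : ∀ {n} → VSet n → VSet n → Set
A ⊆S B = ∀ v → A v ≡ true → B v ≡ true

⊆S-∉ : ∀ {n} {A B : VSet n} → A ⊆S B → ∀ {v} → B v ≡ false → A v ≡ false
⊆S-∉ {A = A} A⊆B {v} Bv≡false with A v in Av
... | false = refl
... | true  = trans (sym (A⊆B v Av)) Bv≡false

∈-∖S : ∀ {n} {A B : VSet n} {v} → A v ≡ true → B v ≡ false → (A ∖S B) v ≡ true
∈-∖S Av Bv rewrite Av | Bv = refl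

∈-∖S⇒∉ : ∀ {n} {A B : VSet n} {v} → (A ∖S B) v ≡ true → B v ≡ false
∈-∖S⇒∉ {A = A} {v = v} v∈A∖B = not-injective (∧-conicalʳ (A v) _ v∈A∖B)

sumF-mono : ∀ {n} {f g : Fin n → ℕ} → (∀ i → f i ≤ g i) → sumF f ≤ sumF g
sumF-mono {zero}  f≤g = z≤n
sumF-mono {suc n} f≤g = +-mono-≤ (f≤g zero) (sumF-mono (λ i → f≤g (suc i)))

sumF-const : ∀ n c → sumF {n} (λ _ → c) ≡ n * c
sumF-const zero    c = refl
sumF-const (suc n) c = cong (c +_) (sumF-const n c)

countF-fullS : ∀ n → countF {n} fullS ≡ n
countF-fullS n = trans (sumF-const n 1) (*-identityʳ n)

indicator-mono : ∀ {a b : Bool} → (a ≡ true → b ≡ true) → (if a then 1 else 0) ≤ (if b then 1 else 0)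
indicator-mono {false}     _   = z≤n
indicator-mono {true}  a⇒b rewrite a⇒b refl = ≤-refl

countF-mono : ∀ {n} {A B : VSet n} → A ⊆S B → countF A ≤ countF B
countF-mono A⊆B = sumF-mono (λ v → indicator-mono (A⊆B v))

countF-< : ∀ {n} {A B : VSet n} → A ⊆S B → ∀ v → A v ≡ false → B v ≡ true → countF A < countF B
countF-< {suc n} {A} {B} A⊆B zero    Av Bv rewrite Av | Bv = s≤s (countF-mono (λ v → A⊆B (suc v)))
countF-< {suc n} {A} {B} A⊆B (suc v) Av Bv =
  +-mono-≤-< (indicator-mono (A⊆B zero)) (countF-< (λ v → A⊆B (suc v)) v Av Bv)

⊂⇒countF< : ∀ {n} {A B : VSet n} → A ⊆S B → ∀ {v} → A v ≢ B v → countF A < countF B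
⊂⇒countF< {A = A} {B} A⊆B {v} Av≢Bv with A v in Av | B v in Bv
... | false | true  = countF-< A⊆B v Av Bv
... | false | false = ⊥-elim (Av≢Bv refl)
... | true  | _     = ⊥-elim (Av≢Bv (sym (trans (sym Bv) (A⊆B v Av))))

countF-≤ : ∀ {n} (A : VSet n) → countF A ≤ n
countF-≤ {n} A = subst (countF A ≤_) (countF-fullS n) (countF-mono {n} {A} {fullS} (λ _ _ → refl))

countF-pos : ∀ {n} (A : VSet n) v → A v ≡ true → 1 ≤ countF A
countF-pos {suc n} A zero    Av rewrite Av = s≤s z≤n
countF-pos {suc n} A (suc v) Av = ≤-trans (countF-pos (λ i → A (suc i)) v Av) (m≤n+m _ _)

module Iteration {n} (step : VSet n → VSet n)
                 (inflationary : ∀ X → X ⊆S step X)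
                 (step-cong : ∀ {X Y} → X ≗ Y → step X ≗ step Y) where

  iterN-⊇ : ∀ k X → X ⊆S iterN k step X
  iterN-⊇ zero    X v Xv = Xv
  iterN-⊇ (suc k) X v Xv = inflationary _ v (iterN-⊇ k X v Xv)

  -- Until it stabilises, every iteration adds a vertex.
  stable-or-large : ∀ k X → step (iterN k step X) ≗ iterN k step X ⊎ k ≤ countF (iterN k step X)
  stable-or-large zero    X = inj₂ z≤n
  stable-or-large (suc k) X with stable-or-large k X
  ... | inj₁ stable = inj₁ (step-cong stable)
  ... | inj₂ k≤size with eqS (step (iterN k step X)) (iterN k step X) in e
  ...   | true  = inj₁ (step-cong (eqS⇒≗ _ _ e))
  ...   | false = inj₂ (≤-trans (s≤s k≤size) (⊂⇒countF< (inflationary Y) (differ ∘ sym)))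
    where
    Y = iterN k step X
    differ = proj₂ (¬eqS⇒∃≢ (step Y) Y e)

  iterN-closed : ∀ X → step (iterN n step X) ⊆S iterN n step X
  iterN-closed X v stepv with stable-or-large n X
  ... | inj₁ stable = trans (sym (stable v)) stepv
  ... | inj₂ n≤size with iterN n step X v in Xv
  ...   | true  = refl
  ...   | false = ⊥-elim (<⇒≱ (countF-< (λ _ _ → refl) v Xv refl) n≤size′)
    where
    n≤size′ : countF {n} fullS ≤ countF (iterN n step X)
    n≤size′ = subst (_≤ countF (iterN n step X)) (sym (countF-fullS n)) n≤size

module Attractors {n} (G : Game n) where

  attrStep-cong : ∀ D τ {X Y : VSet n} → X ≗ Y → attrStep G D τ X ≗ attrStep G D τ Y
  attrStep-cong D τ X≗Y v =
    cong₂ (λ x rest → x ∨ (D v ∧ rest)) (X≗Y v)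
      (cong₂ (if owner G v ==P τ then_else_)
        (anyF-cong (λ w → cong (λ x → D w ∧ E G v w ∧ x) (X≗Y w)))
        (allF-cong (λ w → cong (not (D w ∧ E G v w) ∨_) (X≗Y w))))

  safeStep-cong : ∀ D l τ {X Y : VSet n} → X ≗ Y → safeStep G D l τ X ≗ safeStep G D l τ Y
  safeStep-cong D l τ X≗Y v =
    cong₂ (λ x rest → x ∨ (D v ∧ ⌊ pr G v <? l ⌋ ∧ rest)) (X≗Y v)
      (cong₂ (if owner G v ==P τ then_else_)
        (anyF-cong (λ w → cong (λ x → D w ∧ E G v w ∧ x) (X≗Y w)))
        (allF-cong (λ w → cong (not (D w ∧ E G v w) ∨_) (X≗Y w))))

  attrStep-⊇ : ∀ D τ X → X ⊆S attrStep G D τ X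
  attrStep-⊇ D τ X v Xv rewrite Xv = refl

  safeStep-⊇ : ∀ D l τ X → X ⊆S safeStep G D l τ X
  safeStep-⊇ D l τ X v Xv rewrite Xv = refl

  module AttrIteration D τ = Iteration (attrStep G D τ) (attrStep-⊇ D τ) (attrStep-cong D τ)
  module SafeIteration D l τ = Iteration (safeStep G D l τ) (safeStep-⊇ D l τ) (safeStep-cong D l τ)

  attr-⊇ : ∀ D X τ → (D ∩S X) ⊆S attr G D X τ
  attr-⊇ D X τ = AttrIteration.iterN-⊇ D τ n (D ∩S X)

  attr-closed : ∀ D X τ → attrStep G D τ (attr G D X τ) ⊆S attr G D X τ
  attr-closed D X τ = AttrIteration.iterN-closed D τ (D ∩S X)

  safeAttr-⊇ : ∀ D l X τ → (D ∩S X) ⊆S safeAttr G D l X τ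
  safeAttr-⊇ D l X τ = SafeIteration.iterN-⊇ D l τ n (D ∩S X)

  safeAttr-closed : ∀ D l X τ → safeStep G D l τ (safeAttr G D l X τ) ⊆S safeAttr G D l X τ
  safeAttr-closed D l X τ = SafeIteration.iterN-closed D l τ (D ∩S X)

  -- A σ-vertex outside A has a successor outside A, or A would attract it.  An opponent
  -- vertex outside A has priority below λ, so closedness of S gives it a successor outside S,
  -- and that successor lies outside A, or A would attract the vertex.
  restrict-isGameOn : ∀ σ l {D S : VSet n} → safeStep G D l σ S ⊆S S → IsGameOn G (restrict G (D ∖S S) l σ)
  restrict-isGameOn σ l {D} {S} S-closed v v∈R = move (owner G v ==P σ) refl
    where
    D' = D ∖S S
    target : VSet n
    target u = ⌊ l ≤? pr G u ⌋
    A = attr G D' target (opp σ)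
    R = D' ∖S A

    v∈D' : D' v ≡ true
    v∈D' = ∧-conicalˡ _ _ v∈R
    v∉A : A v ≡ false
    v∉A = ∈-∖S⇒∉ {A = D'} {B = A} v∈R
    not-attracted : attrStep G D' (opp σ) A v ≡ false
    not-attracted = ⊆S-∉ (attr-closed D' target (opp σ)) v∉A

    σ-move : owner G v ==P σ ≡ true → ∃[ w ] (R w ≡ true × E G v w ≡ true)
    σ-move own = w , ∈-∖S {A = D'} {B = A} (∧-conicalˡ _ _ w∈D'∧edge) w∉A , ∧-conicalʳ (D' w) _ w∈D'∧edge
      where
      not-all-into-A : allF (λ w → not (D' w ∧ E G v w) ∨ A w) ≡ false
      not-all-into-A = trans (sym (if-false (trans (==P-opp _ σ) (cong not own))))
                             (∨-∧-false (A v) not-attracted v∈D')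
      escape : ∃[ w ] (not (D' w ∧ E G v w) ∨ A w) ≡ false
      escape = ¬allF⇒∃ _ not-all-into-A
      w : Fin n
      w = proj₁ escape
      w∈D'∧edge : (D' w ∧ E G v w) ≡ true
      w∈D'∧edge = proj₁ (not-∨-false (D' w ∧ E G v w) (proj₂ escape))
      w∉A : A w ≡ false
      w∉A = proj₂ (not-∨-false (D' w ∧ E G v w) (proj₂ escape))

    opp-move : owner G v ==P σ ≡ false → ∃[ w ] (R w ≡ true × E G v w ≡ true)
    opp-move own = w , ∈-∖S {A = D'} {B = A} w∈D' w∉A , edge
      where
      no-edge-into-A : anyF (λ w → D' w ∧ E G v w ∧ A w) ≡ false
      no-edge-into-A = trans (sym (if-true (trans (==P-opp _ σ) (cong not own))))
                             (∨-∧-false (A v) not-attracted v∈D')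
      below-l : ⌊ pr G v <? l ⌋ ≡ true
      below-l = ≰ᵇ⇒>ᵇ l (pr G v) (∧-false v∈D' (⊆S-∉ (attr-⊇ D' target (opp σ)) v∉A))
      not-all-into-S : allF (λ w → not (D w ∧ E G v w) ∨ S w) ≡ false
      not-all-into-S = trans (sym (if-false own))
        (∧-false below-l (∨-∧-false (S v) (⊆S-∉ S-closed (∈-∖S⇒∉ {A = D} {B = S} v∈D'))
                                          (∧-conicalˡ (D v) _ v∈D')))
      escape : ∃[ w ] (not (D w ∧ E G v w) ∨ S w) ≡ false
      escape = ¬allF⇒∃ _ not-all-into-S
      w : Fin n
      w = proj₁ escape
      w∈D∧edge : (D w ∧ E G v w) ≡ true
      w∈D∧edge = proj₁ (not-∨-false (D w ∧ E G v w) (proj₂ escape))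
      edge : E G v w ≡ true
      edge = ∧-conicalʳ (D w) _ w∈D∧edge
      w∈D' : D' w ≡ true
      w∈D' = ∈-∖S {A = D} {B = S} (∧-conicalˡ _ _ w∈D∧edge) (proj₂ (not-∨-false (D w ∧ E G v w) (proj₂ escape)))
      w∉A : A w ≡ false
      w∉A with A w in w∈A
      ... | false = refl
      ... | true  = trans (sym (∃⇒anyF _ w (trans (cong₂ _∧_ w∈D' (cong (_∧ A w) edge)) w∈A))) no-edge-into-A

    move : ∀ b → owner G v ==P σ ≡ b → ∃[ w ] (R w ≡ true × E G v w ≡ true)
    move true  = σ-move
    move false = opp-move

edgesIn-≤ : ∀ {n} (G : Game n) (D : VSet n) → edgesIn G D ≤ edgesIn G fullS
edgesIn-≤ G D = sumF-mono out-degree-≤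
  where
  out-degree-≤ : ∀ v → (if D v then countF (λ w → D w ∧ E G v w) else 0) ≤ countF (λ w → E G v w)
  out-degree-≤ v with D v
  ... | true  = countF-mono (λ w → ∧-conicalʳ (D w) _)
  ... | false = z≤n

module RunningTime (T : ℕ → ℕ → ℕ) (alg : ParAlgorithm)
            (T-mono : ∀ {a b a' b'} → a ≤ a' → b ≤ b' → T a b ≤ T a' b')
            (alg-time : ∀ {k} (G : Game k) (D : VSet k) (σ : Player) → IsGameOn G D
                        → proj₂ (alg G D σ) ≤ T (countF D) (edgesIn G D))
            {n} (G : Game n) (σ : Player) where

  open Attractors G
  open ≤-Reasoning

  m u genRound : ℕ
  m = edgesIn G fullS
  u = unitCost G
  genRound = 3 * u + T n m

  alg-restrict-time : ∀ l C → proj₂ (alg G (restrict G (fullS ∖S safeAttr G fullS l C σ) l σ) σ) ≤ T n m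
  alg-restrict-time l C =
    ≤-trans (alg-time G _ σ (restrict-isGameOn σ l (safeAttr-closed fullS l C σ)))
            (T-mono (countF-≤ _) (edgesIn-≤ G _))

  -- Potential argument: every round but the last adds a vertex to C.
  GenTime : VSet n → VSet n × ℕ → Set
  GenTime C (C' , t) = t + genRound * countF C ≤ genRound * suc (countF C')

  genLoop-time : ∀ f l C → GenTime C (genLoop G σ alg f l C)
  genLoop-time zero    l C = *-monoʳ-≤ genRound (n≤1+n _)
  genLoop-time (suc f) l C with alg G (restrict G (fullS ∖S safeAttr G fullS l C σ) l σ) σ | alg-restrict-time l C
  ... | R , k | k≤T = if-elim (GenTime C) (eqS C' C) stable unstable
    where
    S = safeAttr G fullS l C σ
    C' = S ∪S (restrict G (fullS ∖S S) l σ ∩S R)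

    C⊆C' : C ⊆S C'
    C⊆C' v Cv rewrite safeAttr-⊇ fullS l C σ v Cv = refl

    round-time : 3 * u + k ≤ genRound
    round-time = +-monoʳ-≤ (3 * u) k≤T

    stable : eqS C' C ≡ true → GenTime C (C' , 3 * u + k)
    stable _ = begin
      3 * u + k + genRound * countF C   ≤⟨ +-mono-≤ round-time (*-monoʳ-≤ genRound (countF-mono C⊆C')) ⟩
      genRound + genRound * countF C'   ≡⟨ *-suc genRound _ ⟨
      genRound * suc (countF C')        ∎

    unstable : eqS C' C ≡ false → GenTime C (addCost (3 * u + k) (genLoop G σ alg f l C'))
    unstable e with genLoop G σ alg f l C' | genLoop-time f l C'
    ... | C'' , t | rest = begin
      3 * u + k + t + genRound * countF C     ≡⟨ xy∙z≈y∙xz (3 * u + k) t _ ⟩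
      t + (3 * u + k + genRound * countF C)   ≤⟨ +-monoʳ-≤ t (+-monoˡ-≤ _ round-time) ⟩
      t + (genRound + genRound * countF C)    ≡⟨ cong (t +_) (*-suc genRound _) ⟨
      t + genRound * suc (countF C)           ≤⟨ +-monoʳ-≤ t (*-monoʳ-≤ genRound C⊂C') ⟩
      t + genRound * countF C'                ≤⟨ rest ⟩
      genRound * suc (countF C'')             ∎
      where
      C⊂C' : countF C < countF C'
      C⊂C' = ⊂⇒countF< C⊆C' (proj₂ (¬eqS⇒∃≢ C' C e) ∘ sym)

  seqOverhead : ℕ → ℕ
  seqOverhead f = suc f * (2 * u)

  u≤seqOverhead : ∀ f → u ≤ seqOverhead f
  u≤seqOverhead f = ≤-trans (m≤m+n u (u + 0)) (m≤m+n (2 * u) (f * (2 * u)))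

  SeqTime : ℕ → VSet n → VSet n × ℕ → Set
  SeqTime f C (C' , t) = t + genRound * countF C ≤ genRound * countF C' + seqOverhead f

  idle-time : ∀ f C → SeqTime f C (C , u)
  idle-time f C = subst (_≤ genRound * countF C + seqOverhead f) (+-comm (genRound * countF C) u)
                        (+-monoʳ-≤ (genRound * countF C) (u≤seqOverhead f))

  -- Each call of GenAttr starts from C extended by a vertex of W, which pays for its +1.
  seqLoop-time : ∀ f W C → (∀ v → W v ≡ true → C v ≡ false) → SeqTime f C (seqLoop G σ alg f W C)
  seqLoop-time zero    W C W∩C≡∅ = m≤m+n _ _
  seqLoop-time (suc f) W C W∩C≡∅ with anyF W | firstF (maxS G W) in first
  ... | false | _      = idle-time (suc f) C
  ... | true  | nothing = idle-time (suc f) C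
  ... | true  | just s with genAttr G σ alg (pr G s) (C ∪S maxS G W) | genLoop-time (suc n) (pr G s) (C ∪S maxS G W)
  ...   | C' , k | gen with seqLoop G σ alg f (W ∖S C') C' | seqLoop-time f (W ∖S C') C' (λ v → ∈-∖S⇒∉ {A = W} {B = C'})
  ...     | C'' , k' | rest = begin
    2 * u + k + k' + genRound * countF C        ≡⟨ regroup (2 * u) k k' _ ⟩
    2 * u + (k' + (k + genRound * countF C))    ≤⟨ +-monoʳ-≤ (2 * u) (+-monoʳ-≤ k' gen-time) ⟩
    2 * u + (k' + genRound * countF C')         ≤⟨ +-monoʳ-≤ (2 * u) rest ⟩
    2 * u + (genRound * countF C'' + seqOverhead f) ≡⟨ x∙yz≈y∙xz (2 * u) (genRound * countF C'') (seqOverhead f) ⟩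
    genRound * countF C'' + seqOverhead (suc f) ∎
    where
    regroup : ∀ a b c d → a + b + c + d ≡ a + (c + (b + d))
    regroup = solve-∀
    s∈maxW : maxS G W s ≡ true
    s∈maxW = firstF-just _ first
    C⊂C∪maxW : countF C < countF (C ∪S maxS G W)
    C⊂C∪maxW = countF-< (λ v Cv → cong (_∨ maxS G W v) Cv) s (W∩C≡∅ s (∧-conicalˡ _ _ s∈maxW))
                        (trans (cong (C s ∨_) s∈maxW) (∨-zeroʳ (C s)))
    gen-time : k + genRound * countF C ≤ genRound * countF C'
    gen-time = +-cancelˡ-≤ genRound _ _ (begin
      genRound + (k + genRound * countF C)   ≡⟨ x∙yz≈y∙xz genRound k _ ⟩
      k + (genRound + genRound * countF C)   ≡⟨ cong (k +_) (*-suc genRound _) ⟨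
      k + genRound * suc (countF C)          ≤⟨ +-monoʳ-≤ k (*-monoʳ-≤ genRound C⊂C∪maxW) ⟩
      k + genRound * countF (C ∪S maxS G W)  ≤⟨ gen ⟩
      genRound * suc (countF C')             ≡⟨ *-suc genRound _ ⟩
      genRound + genRound * countF C'        ∎)

  seqLoop-idle : ∀ f W C → anyF W ≡ false → proj₂ (seqLoop G σ alg (suc f) W C) ≡ u
  seqLoop-idle f W C W≡∅ with anyF W | firstF (maxS G W)
  seqLoop-idle f W C ()  | true  | _
  seqLoop-idle f W C W≡∅ | false | _ = refl

  seqAttr-time-≤ : ∀ X → proj₂ (seqAttr G σ alg X) ≤ genRound * n + seqOverhead (suc n)
  seqAttr-time-≤ X with seqAttr G σ alg X | seqLoop-time (suc n) (ownedBy G σ ∩S X) emptyS (λ _ _ → refl)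
  ... | C , t | bound = begin
    t                                         ≤⟨ m≤m+n t _ ⟩
    t + genRound * countF {n} emptyS          ≤⟨ bound ⟩
    genRound * countF C + seqOverhead (suc n) ≤⟨ +-monoˡ-≤ _ (*-monoʳ-≤ genRound (countF-≤ C)) ⟩
    genRound * n + seqOverhead (suc n)        ∎

  seqAttr-time : ∀ X → proj₂ (seqAttr G σ alg X) ≤ genRound * n * countF X + seqOverhead (suc n)
  seqAttr-time X = by-emptiness (anyF (ownedBy G σ ∩S X)) refl
    where
    by-emptiness : ∀ b → anyF (ownedBy G σ ∩S X) ≡ b
                   → proj₂ (seqAttr G σ alg X) ≤ genRound * n * countF X + seqOverhead (suc n)
    by-emptiness true W≢∅ =
      ≤-trans (seqAttr-time-≤ X) (+-monoˡ-≤ (seqOverhead (suc n)) (begin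
        genRound * n              ≡⟨ *-identityʳ (genRound * n) ⟨
        genRound * n * 1          ≤⟨ *-monoʳ-≤ (genRound * n) X≢∅ ⟩
        genRound * n * countF X   ∎))
      where
      X≢∅ : 1 ≤ countF X
      X≢∅ = let w , w∈W = anyF⇒∃ _ W≢∅ in countF-pos X w (∧-conicalʳ (ownedBy G σ w) _ w∈W)
    by-emptiness false W≡∅ =
      ≤-trans (≤-reflexive (seqLoop-idle n _ emptyS W≡∅))
        (≤-trans (u≤seqOverhead (suc n)) (m≤n+m (seqOverhead (suc n)) (genRound * n * countF X)))

  tdaRound : ℕ
  tdaRound = 2 * u + seqOverhead (suc n)

  tdaLoop-time : ∀ f X → proj₂ (tdaLoop G σ alg f X) ≤ genRound * n * countF X + f * tdaRound
  tdaLoop-time zero    X = z≤n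
  tdaLoop-time (suc f) X with seqAttr G σ alg X | seqAttr-time X | seqAttr-time-≤ X
  ... | C , k | seq-time | seq-time-≤ =
    if-elim (λ r → proj₂ r ≤ genRound * n * countF X + suc f * tdaRound) (eqS X' X) stable unstable
    where
    X' : VSet n
    X' v = X v ∧ not (ownedBy G σ v ∧ not (anyF (λ w → E G v w ∧ C w)))

    stable : eqS X' X ≡ true → 2 * u + k ≤ genRound * n * countF X + suc f * tdaRound
    stable _ = begin
      2 * u + k                                                ≤⟨ +-monoʳ-≤ (2 * u) seq-time ⟩
      2 * u + (genRound * n * countF X + seqOverhead (suc n))  ≡⟨ x∙yz≈y∙xz (2 * u) (genRound * n * countF X) (seqOverhead (suc n)) ⟩
      genRound * n * countF X + tdaRound                       ≤⟨ +-monoʳ-≤ (genRound * n * countF X) (m≤m+n tdaRound (f * tdaRound)) ⟩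
      genRound * n * countF X + suc f * tdaRound               ∎

    unstable : eqS X' X ≡ false → 2 * u + k + proj₂ (tdaLoop G σ alg f X') ≤ genRound * n * countF X + suc f * tdaRound
    unstable e = begin
      2 * u + k + proj₂ (tdaLoop G σ alg f X')
        ≤⟨ +-mono-≤ (+-monoʳ-≤ (2 * u) seq-time-≤) (tdaLoop-time f X') ⟩
      2 * u + (genRound * n + seqOverhead (suc n)) + (genRound * n * countF X' + f * tdaRound)
        ≡⟨ regroup (2 * u) (genRound * n) (seqOverhead (suc n)) (countF X') (f * tdaRound) ⟩
      genRound * n * suc (countF X') + suc f * tdaRound
        ≤⟨ +-monoˡ-≤ _ (*-monoʳ-≤ (genRound * n) X'⊂X) ⟩
      genRound * n * countF X + suc f * tdaRound ∎
      where
      regroup : ∀ a b c x d → a + (b + c) + (b * x + d) ≡ b * suc x + ((a + c) + d)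
      regroup = solve-∀
      X'⊂X : countF X' < countF X
      X'⊂X = ⊂⇒countF< (λ v → ∧-conicalˡ (X v) _) (proj₂ (¬eqS⇒∃≢ X' X e))

  tda-time : proj₂ (tda G σ alg) ≤ genRound * n * n + suc n * tdaRound
  tda-time = ≤-trans (tdaLoop-time (suc n) (ownedBy G σ)) (+-monoˡ-≤ _ (*-monoʳ-≤ (genRound * n) (countF-≤ _)))

n≤edgesIn : ∀ {n} (G : Game n) → IsGameOn G fullS → n ≤ edgesIn G fullS
n≤edgesIn {n} G isGame = subst (_≤ edgesIn G fullS) (countF-fullS n) (sumF-mono has-successor)
  where
  has-successor : ∀ v → 1 ≤ countF (λ w → E G v w)
  has-successor v = let w , _ , edge = isGame v refl in countF-pos _ w edge

edgesIn≤n*n : ∀ {n} (G : Game n) → edgesIn G fullS ≤ n * n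
edgesIn≤n*n {n} G = subst (edgesIn G fullS ≤_) (sumF-const n n) (sumF-mono (λ v → countF-≤ (E G v)))

overhead-≤ : ∀ n m → n ≤ m → m ≤ n * n → (n + m) * (3 * n * n + 2 * suc n * (3 + n)) ≤ 38 * m * n * n
overhead-≤ zero    m _   m≤0 with n≤0⇒n≡0 m≤0
... | refl = z≤n
overhead-≤ (suc k) m n≤m _ = begin
  (n + m) * P              ≤⟨ *-monoˡ-≤ P (+-monoˡ-≤ m n≤m) ⟩
  (m + m) * P              ≤⟨ *-monoʳ-≤ (m + m) P≤19n² ⟩
  (m + m) * (19 * n * n)   ≡⟨ double m n ⟩
  38 * m * n * n           ∎
  where
  open ≤-Reasoning
  n = suc k
  P = 3 * n * n + 2 * suc n * (3 + n)
  slack : ∀ k → 3 * suc k * suc k + 2 * suc (suc k) * (3 + suc k) + (14 * k * k + 20 * k) ≡ 19 * suc k * suc k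
  slack = solve-∀
  P≤19n² : P ≤ 19 * n * n
  P≤19n² = subst (P ≤_) (slack k) (m≤m+n P (14 * k * k + 20 * k))
  double : ∀ m n → (m + m) * (19 * n * n) ≡ 38 * m * n * n
  double = solve-∀

tda-bound-arith : ∀ n m t → n ≤ m → m ≤ n * n →
  (3 * (n + m) + t) * n * n + suc n * (2 * (n + m) + suc (suc n) * (2 * (n + m))) ≤ 38 * m * n * n + n * n * t
tda-bound-arith n m t n≤m m≤n² = begin
  (3 * (n + m) + t) * n * n + suc n * (2 * (n + m) + suc (suc n) * (2 * (n + m)))
    ≡⟨ expand n m t ⟩
  (n + m) * (3 * n * n + 2 * suc n * (3 + n)) + n * n * t
    ≤⟨ +-monoˡ-≤ (n * n * t) (overhead-≤ n m n≤m m≤n²) ⟩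
  38 * m * n * n + n * n * t ∎
  where
  open ≤-Reasoning
  expand : ∀ n m t → (3 * (n + m) + t) * n * n + suc n * (2 * (n + m) + suc (suc n) * (2 * (n + m)))
                     ≡ (n + m) * (3 * n * n + 2 * suc n * (3 + n)) + n * n * t
  expand = solve-∀

tdaTime≡ : ∀ {n} (G : Game n) (σ : Player) (alg : ParAlgorithm) → tdaTime G σ alg ≡ proj₂ (tda G σ alg)
tdaTime≡ G σ alg with tda G σ alg
... | _ , t = refl

mainTheorem18 : ∃[ c ] ∀ (T : ℕ → ℕ → ℕ) (alg : ParAlgorithm)
                  → (∀ {a b a' b'} → a ≤ a' → b ≤ b' → T a b ≤ T a' b')
                  → (∀ {k} (G : Game k) (D : VSet k) (σ : Player) → IsGameOn G D
                       → proj₂ (alg G D σ) ≤ T (countF D) (edgesIn G D))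
                  → ∀ {n} (G : Game n) (σ : Player) → IsGameOn G fullS
                  → tdaTime G σ alg ≤ c * edgesIn G fullS * n * n + n * n * T n (edgesIn G fullS)
mainTheorem18 = 38 , λ T alg T-mono alg-time {n} G σ isGame →
  let open RunningTime T alg T-mono alg-time G σ in begin
    tdaTime G σ alg                       ≡⟨ tdaTime≡ G σ alg ⟩
    proj₂ (tda G σ alg)                   ≤⟨ tda-time ⟩
    genRound * n * n + suc n * tdaRound   ≤⟨ tda-bound-arith n m (T n m) (n≤edgesIn G isGame) (edgesIn≤n*n G) ⟩
    38 * m * n * n + n * n * T n m        ∎
  where open ≤-Reasoning
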